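{- Let $K$ be a henselian valued field of characteristic $0$ with value group $V$, and let $0\le\delta_1,\ldots,\delta_n\in V$. Then there is a formula $\psi$ with no field-sorted quantifiers (only quantifiers over leading term sorts) such that for all $z_1,\ldots,z_n,a_1,\ldots,a_n\in K$, $$K\models\exists x\ \bigwedge_{i\leq n}\mathrm{rv}_{\delta_i}(z_i)=\mathrm{rv}_{\delta_i}(x-a_i)$$ if and only if $\psi$ holds of the parameters $\mathrm{rv}_{\delta_i}(z_i)$ ($i\le n$), $\mathrm{rv}_{\delta_i}(a_i-a_j)$ ($i,j\le n$), and elements $\mathbf{d}_i$ of the leading term sorts with $v(\mathbf{d}_i)=\delta_i$.
   Context: $\mathrm{RV}_\delta=K^\times/(1+\mathfrak{m}_\delta)$ where $\mathfrak{m}_\delta=\{x: v(x)>\delta\}$, with quotient map $\mathrm{rv}_\delta$ and $\mathrm{rv}_\delta(0)=\infty$. The leading term language is the multisorted language with a field sort $K$ (ring language) and sorts $\mathrm{RV}_\delta$ for $\delta$ in a set $\Delta\subseteq\{\delta\in V:0\le\delta<\infty\}$ (here containing the $\delta_i$), each carrying its multiplication and the relation $\oplus_\delta(\mathbf{x},\mathbf{y},\mathbf{z})$ (holding iff $\mathbf{x}=\mathrm{rv}_\delta(a)$, $\mathbf{y}=\mathrm{rv}_\delta(b)$, $\mathbf{z}=\mathrm{rv}_\delta(a+b)$ for some $a,b\in K$), together with the maps $\mathrm{rv}_\delta:K\to\mathrm{RV}_\delta$ and the natural maps $\mathrm{rv}_{\gamma\to\delta}:\mathrm{RV}_\gamma\to\mathrm{RV}_\delta$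 for $\gamma\ge\delta$ in $\Delta$. The valuation of $\mathbf{x}\in\mathrm{RV}_\delta$ is that of any preimage. -}

module Defs where

open import Level using (0ℓ)
open import Data.Nat using (ℕ; zero; suc)
open import Data.List using (List; []; _∷_; last)
open import Data.List.Relation.Unary.All using (All)
open import Data.Maybe using (Maybe; just)
open import Data.Product using (Σ; ∃; _×_; _,_)
open import Data.Sum using (_⊎_; inj₁; inj₂)
open import Data.Empty using (⊥)
open import Data.Unit using (⊤)
open import Data.Fin using (Fin)
open import Relation.Nullary using (¬_)
open import Relation.Binary.PropositionalEquality using (_≡_)
open import Algebra.Structures using (IsAbelianGroup; IsCommutativeRing)
open import Relation.Binary.Structures using (IsTotalOrder)

data Val (Γ : Set) : Set where
  fin : Γ → Val Γ
  ∞   : Val Γ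

record OrderedAbelianGroup : Set₁ where
  infixl 6 _+ᵥ_
  infix 4 _≤ᵥ_
  field
    Γ              : Set
    _+ᵥ_           : Γ → Γ → Γ
    0ᵥ             : Γ
    -ᵥ_            : Γ → Γ
    _≤ᵥ_           : Γ → Γ → Set
    isAbelianGroup : IsAbelianGroup _≡_ _+ᵥ_ 0ᵥ -ᵥ_
    isTotalOrder   : IsTotalOrder _≡_ _≤ᵥ_
    +-mono         : ∀ {x y} z → x ≤ᵥ y → (x +ᵥ z) ≤ᵥ (y +ᵥ z)

  _<ᵥ_ : Γ → Γ → Set
  x <ᵥ y = x ≤ᵥ y × ¬ x ≡ y

  _≤∞_ : Val Γ → Val Γ → Set
  _     ≤∞ ∞     = ⊤
  ∞     ≤∞ fin _ = ⊥
  fin x ≤∞ fin y = x ≤ᵥ y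

  _<∞_ : Val Γ → Val Γ → Set
  ∞     <∞ _     = ⊥
  fin _ <∞ ∞     = ⊤
  fin x <∞ fin y = x <ᵥ y

  _+∞_ : Val Γ → Val Γ → Val Γ
  fin x +∞ fin y = fin (x +ᵥ y)
  _     +∞ _     = ∞

record ValuedField (G : OrderedAbelianGroup) : Set₁ where
  open OrderedAbelianGroup G
  infixl 6 _+_ _-_
  infixl 7 _*_
  field
    K          : Set
    _+_ _*_    : K → K → K
    -_         : K → K
    0# 1#      : K
    isCommRing : IsCommutativeRing _≡_ _+_ _*_ -_ 0# 1#
    0≢1        : ¬ 0# ≡ 1#
    inverse    : ∀ x → ¬ x ≡ 0# → ∃ λ y → x * y ≡ 1#
    v          : K → Val Γ
    v-∞        : ∀ x → v x ≡ ∞ → x ≡ 0#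
    v-0        : v 0# ≡ ∞
    v-mul      : ∀ x y → v (x * y) ≡ (v x +∞ v y)
    v-add      : ∀ x y → (v x ≤∞ v (x + y)) ⊎ (v y ≤∞ v (x + y))
    v-onto     : ∀ γ → ∃ λ x → v x ≡ fin γ

  _-_ : K → K → K
  x - y = x + (- y)

  _·ℕ_ : ℕ → K → K
  zero  ·ℕ x = 0#
  suc n ·ℕ x = x + (n ·ℕ x)

  InO : K → Set
  InO x = fin 0ᵥ ≤∞ v x

  -- polynomials as coefficient lists [c₀, c₁, …, cₙ]
  eval : List K → K → K
  eval []       x = 0#
  eval (c ∷ cs) x = c + x * eval cs x

  deriv : List K → List K
  deriv []       = []
  deriv (_ ∷ cs) = go 1 cs
    where
    go : ℕ → List K → List K
    go k []       = []
    go k (c ∷ cs) = (k ·ℕ c) ∷ go (suc k) cs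

  Monic : List K → Set
  Monic f = last f ≡ just 1#

  Henselian : Set
  Henselian = ∀ (f : List K) → Monic f → All InO f →
              ∀ a → InO a → fin 0ᵥ <∞ v (eval f a) → v (eval (deriv f) a) ≡ fin 0ᵥ →
              ∃ λ b → eval f b ≡ 0# × fin 0ᵥ <∞ v (b - a)

  CharZero : Set
  CharZero = ∀ n → ¬ (suc n ·ℕ 1#) ≡ 0#

  -- RV_δ = (K^× / (1 + 𝔪_δ)) ∪ {∞}, represented by elements of K
  -- (rv_δ a is represented by a) modulo the following equality:
  -- rv_δ a = rv_δ b  iff  a = b = 0, or a,b ≠ 0 and v(a/b - 1) > δ,
  -- i.e. v(a - b) > v(b) + δ.
  _≈rv[_]_ : K → Γ → K → Set
  a ≈rv[ δ ] b = (a ≡ 0# × b ≡ 0#)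
               ⊎ (¬ a ≡ 0# × ¬ b ≡ 0# × ((v b +∞ fin δ) <∞ v (a - b)))

-- The leading term language (sorts K and RV_δ, 0 ≤ δ ∈ Γ), restricted to
-- formulas without field-sorted quantifiers.  Free variables range over
-- an arbitrary sort-indexed family X.

module LeadingTerm (G : OrderedAbelianGroup) where
  open OrderedAbelianGroup G

  data Sort : Set where
    fld : Sort
    rvS : (δ : Γ) → 0ᵥ ≤ᵥ δ → Sort

  data Ext (X : Sort → Set) (s : Sort) : Sort → Set where
    old : ∀ {t} → X t → Ext X s t
    new : Ext X s s

  data Term (X : Sort → Set) : Sort → Set where
    var   : ∀ {s} → X s → Term X s
    zeroT oneT : Term X fld
    addT mulT  : Term X fld → Term X fld → Term X fld
    negT  : Term X fld → Term X fld
    rvT   : ∀ δ p → Term X fld → Term X (rvS δ p)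
    mulR  : ∀ {δ p} → Term X (rvS δ p) → Term X (rvS δ p) → Term X (rvS δ p)
    projT : ∀ {γ δ p q} → δ ≤ᵥ γ → Term X (rvS γ p) → Term X (rvS δ q)

  data Formula (X : Sort → Set) : Set where
    ⊤F ⊥F  : Formula X
    eqF    : ∀ {s} → Term X s → Term X s → Formula X
    ⊕F     : ∀ {δ p} → Term X (rvS δ p) → Term X (rvS δ p) → Term X (rvS δ p) → Formula X
    notF   : Formula X → Formula X
    andF orF : Formula X → Formula X → Formula X
    existsRV forallRV : ∀ δ p → Formula (Ext X (rvS δ p)) → Formula X

  -- Semantics in a valued field: elements of every sort are represented by
  -- elements of K (an element of RV_δ by any preimage under rv_δ).
  module Semantics (F : ValuedField G) where
    open ValuedField F

    Env : (Sort → Set) → Set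
    Env X = ∀ {s} → X s → K

    extend : ∀ {X s} → Env X → K → Env (Ext X s)
    extend ρ k (old x) = ρ x
    extend ρ k new     = k

    ⟦_⟧t : ∀ {X s} → Term X s → Env X → K
    ⟦ var x ⟧t ρ       = ρ x
    ⟦ zeroT ⟧t ρ       = 0#
    ⟦ oneT ⟧t ρ        = 1#
    ⟦ addT t u ⟧t ρ    = ⟦ t ⟧t ρ + ⟦ u ⟧t ρ
    ⟦ mulT t u ⟧t ρ    = ⟦ t ⟧t ρ * ⟦ u ⟧t ρ
    ⟦ negT t ⟧t ρ      = - ⟦ t ⟧t ρ
    ⟦ rvT δ p t ⟧t ρ   = ⟦ t ⟧t ρ
    ⟦ mulR t u ⟧t ρ    = ⟦ t ⟧t ρ * ⟦ u ⟧t ρ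
    ⟦ projT _ t ⟧t ρ   = ⟦ t ⟧t ρ

    EqS : Sort → K → K → Set
    EqS fld       a b = a ≡ b
    EqS (rvS δ _) a b = a ≈rv[ δ ] b

    Sat : ∀ {X} → Formula X → Env X → Set
    Sat ⊤F ρ = ⊤
    Sat ⊥F ρ = ⊥
    Sat (eqF {s} t u) ρ = EqS s (⟦ t ⟧t ρ) (⟦ u ⟧t ρ)
    Sat (⊕F {δ} t u w) ρ = ∃ λ a → ∃ λ b →
      a ≈rv[ δ ] ⟦ t ⟧t ρ × b ≈rv[ δ ] ⟦ u ⟧t ρ × (a + b) ≈rv[ δ ] ⟦ w ⟧t ρ
    Sat (notF φ) ρ = ¬ Sat φ ρ
    Sat (andF φ χ) ρ = Sat φ ρ × Sat χ ρ
    Sat (orF φ χ) ρ = Sat φ ρ ⊎ Sat χ ρ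
    Sat (existsRV δ p φ) ρ = ∃ λ a → Sat φ (extend ρ a)
    Sat (forallRV δ p φ) ρ = ∀ a → Sat φ (extend ρ a)

module Params (G : OrderedAbelianGroup) where
  open OrderedAbelianGroup G
  open LeadingTerm G

  -- free variables: rv_{δᵢ}(zᵢ), rv_{δᵢ}(aᵢ - aⱼ), 𝐝ᵢ, all in sort RV_{δᵢ}
  data Param (n : ℕ) (δ : Fin n → Γ) (nn : ∀ i → 0ᵥ ≤ᵥ δ i) : Sort → Set where
    zP : (i : Fin n) → Param n δ nn (rvS (δ i) (nn i))
    aP : (i j : Fin n) → Param n δ nn (rvS (δ i) (nn i))
    dP : (i : Fin n) → Param n δ nn (rvS (δ i) (nn i))

  module _ (F : ValuedField G) where
    open ValuedField F

    paramEnv : ∀ {n δ nn} → (z a d : Fin n → K) → ∀ {s} → Param n δ nn s → K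
    paramEnv z a d (zP i)   = z i
    paramEnv z a d (aP i j) = a i - a j
    paramEnv z a d (dP i)   = d i

module Submission where

-- Write ρᵢ = v(zᵢ) + δᵢ.  The condition rv_δ(z) = rv_δ(y) says that z - y
-- is "ρ-small" (valuation > ρ) for ρ = v(y) + δ; this notion is closed
-- under sums and negation, which is all the valuation theory used.
--
-- ψ is the conjunction over all pairs i, j, with δⱼ ≤ δᵢ say, of
--   ∃ w ∈ RV_{δᵢ}:  ⊕(rv(zᵢ), rv(aᵢ - aⱼ), w)  ∧  rv_{δᵢ→δⱼ}(w) = rv(zⱼ),
-- i.e. "zᵢ + (aᵢ - aⱼ) and zⱼ agree to the coarser precision".  A solution x
-- makes ψ true with w = x - aⱼ.  Conversely pick k with ρₖ maximal and put
-- x = zₖ + aₖ.  The key lemma 'sum-close' shows that the ⊕-witness of the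
-- pair {j, k} forces zₖ + (aₖ - aⱼ) - zⱼ to be ρⱼ-small; the only delicate
-- term is the error of q ≈ aₖ - aⱼ, which is handled by comparing
-- valuations (a cancellation would contradict the maximality of ρₖ).

open import Defs
open import Level using (0ℓ)
open import Axiom.ExcludedMiddle using (ExcludedMiddle)
open import Data.Nat using (ℕ; zero; suc)
open import Data.Fin using (Fin)
import Data.Fin as Fin
open import Data.Product using (∃; _×_; _,_; proj₁)
open import Data.Sum using (_⊎_; inj₁; inj₂)
open import Data.Empty using (⊥-elim)
open import Data.Unit using (tt)
open import Relation.Nullary using (¬_; yes; no)
open import Relation.Binary.PropositionalEquality
open import Relation.Binary.Structures using (IsTotalOrder)
import Relation.Binary.Construct.NonStrictToStrict as NonStrictToStrict
open import Algebra.Bundles using (CommutativeRing; Group)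
open import Algebra.Structures using (IsAbelianGroup; IsCommutativeRing)
import Algebra.Properties.Group as GroupProperties

module ExtendedValues (EM : ExcludedMiddle 0ℓ) (G : OrderedAbelianGroup) where
  open OrderedAbelianGroup G
  private
    module TO = IsTotalOrder isTotalOrder
    module AG = IsAbelianGroup isAbelianGroup
    module Strict = NonStrictToStrict _≡_ _≤ᵥ_

  fin-injective : ∀ {x y : Γ} → fin x ≡ fin y → x ≡ y
  fin-injective refl = refl

  ≤∞-refl : ∀ {x} → x ≤∞ x
  ≤∞-refl {fin x} = TO.refl
  ≤∞-refl {∞}     = tt

  ≤∞-trans : ∀ {x y z} → x ≤∞ y → y ≤∞ z → x ≤∞ z
  ≤∞-trans {z = ∞}                     _ _ = tt
  ≤∞-trans {fin x} {fin y} {fin z} p q = TO.trans p q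
  ≤∞-trans {fin x} {∞}     {fin z} _ ()
  ≤∞-trans {∞}     {∞}     {fin z} _ ()

  ≤∞-antisym : ∀ {x y} → x ≤∞ y → y ≤∞ x → x ≡ y
  ≤∞-antisym {fin x} {fin y} p q = cong fin (TO.antisym p q)
  ≤∞-antisym {∞}     {∞}     _ _ = refl

  <⇒≤∞ : ∀ {x y} → x <∞ y → x ≤∞ y
  <⇒≤∞ {fin x} {fin y} p = proj₁ p
  <⇒≤∞ {fin x} {∞}     _ = tt

  <-≤-trans∞ : ∀ {x y z} → x <∞ y → y ≤∞ z → x <∞ z
  <-≤-trans∞ {fin x} {fin y} {fin z} p q =
    Strict.<-≤-trans sym TO.trans TO.antisym TO.≤-respʳ-≈ p q
  <-≤-trans∞ {fin x} {_}     {∞}     _ _ = tt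

  ≤-<-trans∞ : ∀ {x y z} → x ≤∞ y → y <∞ z → x <∞ z
  ≤-<-trans∞ {fin x} {fin y} {fin z} p q =
    Strict.≤-<-trans TO.trans TO.antisym TO.≤-respˡ-≈ p q
  ≤-<-trans∞ {fin x} {fin y} {∞}     _ _ = tt

  <∞-irrefl : ∀ {x} → ¬ x <∞ x
  <∞-irrefl {fin x} p = Strict.<-irrefl refl p

  ≤⇒≯∞ : ∀ {x y} → x ≤∞ y → ¬ y <∞ x
  ≤⇒≯∞ p q = <∞-irrefl (≤-<-trans∞ p q)

  -- Trichotomy, in the form needed for case distinctions; it is here that
  -- excluded middle (decidability of equality in Γ) enters.
  ≤-or->∞ : ∀ x y → x ≤∞ y ⊎ y <∞ x
  ≤-or->∞ _       ∞       = inj₁ tt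
  ≤-or->∞ ∞       (fin y) = inj₂ tt
  ≤-or->∞ (fin x) (fin y) with EM {x ≡ y} | TO.total x y
  ... | yes x≡y | _       = inj₁ (TO.reflexive x≡y)
  ... | no _    | inj₁ x≤y = inj₁ x≤y
  ... | no x≢y  | inj₂ y≤x = inj₂ (y≤x , λ y≡x → x≢y (sym y≡x))

  ≤∞-total : ∀ x y → x ≤∞ y ⊎ y ≤∞ x
  ≤∞-total x y with ≤-or->∞ x y
  ... | inj₁ x≤y = inj₁ x≤y
  ... | inj₂ y<x = inj₂ (<⇒≤∞ y<x)

  -- Shifting an extended value by δ ∈ Γ (the threshold v(b) + δ of rv_δ).
  _⊹_ : Val Γ → Γ → Val Γ
  x ⊹ δ = x +∞ fin δ

  ⊹-monoˡ : ∀ {x y} δ → x ≤∞ y → (x ⊹ δ) ≤∞ (y ⊹ δ)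
  ⊹-monoˡ {fin x} {fin y} δ p = +-mono δ p
  ⊹-monoˡ {_}     {∞}     δ _ = tt

  ⊹-monoʳ : ∀ x {δ δ′} → δ ≤ᵥ δ′ → (x ⊹ δ) ≤∞ (x ⊹ δ′)
  ⊹-monoʳ (fin x) {δ} {δ′} p = subst₂ _≤ᵥ_ (AG.comm δ x) (AG.comm δ′ x) (+-mono x p)
  ⊹-monoʳ ∞       _          = tt

  ≤-⊹ : ∀ x {δ} → 0ᵥ ≤ᵥ δ → x ≤∞ (x ⊹ δ)
  ≤-⊹ x {δ} 0≤δ = subst (_≤∞ (x ⊹ δ)) (right-unit x) (⊹-monoʳ x 0≤δ)
    where
    right-unit : ∀ x → (x ⊹ 0ᵥ) ≡ x
    right-unit (fin x) = cong fin (AG.identityʳ x)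
    right-unit ∞       = refl

  ⊹-cancel-< : ∀ {x y} δ → (x ⊹ δ) <∞ (y ⊹ δ) → x <∞ y
  ⊹-cancel-< {x} {y} δ h with ≤-or->∞ y x
  ... | inj₁ y≤x = ⊥-elim (≤⇒≯∞ (⊹-monoˡ {y} {x} δ y≤x) h)
  ... | inj₂ x<y = x<y

  maximum : ∀ m (f : Fin m → Val Γ) → (∃ λ k → ∀ j → f j ≤∞ f k) ⊎ ¬ Fin m
  maximum zero    f = inj₂ λ ()
  maximum (suc m) f with maximum m (λ i → f (Fin.suc i))
  ... | inj₂ empty = inj₁ (Fin.zero , λ { Fin.zero    → ≤∞-refl {f Fin.zero}
                                       ; (Fin.suc j) → ⊥-elim (empty j) })
  ... | inj₁ (k , max) with ≤∞-total (f Fin.zero) (f (Fin.suc k))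
  ...   | inj₁ f0≤fk = inj₁ (Fin.suc k , λ { Fin.zero    → f0≤fk
                                          ; (Fin.suc j) → max j })
  ...   | inj₂ fk≤f0 = inj₁ (Fin.zero , λ { Fin.zero    → ≤∞-refl {f Fin.zero}
                                         ; (Fin.suc j) → ≤∞-trans {f (Fin.suc j)} {f (Fin.suc k)} {f Fin.zero}
                                                           (max j) fk≤f0 })

  double-zero : ∀ h → h +ᵥ h ≡ 0ᵥ → h ≡ 0ᵥ
  double-zero h e with TO.total h 0ᵥ
  ... | inj₁ h≤0 = TO.antisym h≤0 (subst₂ _≤ᵥ_ e (AG.identityˡ h) (+-mono h h≤0))
  ... | inj₂ 0≤h = TO.antisym (subst₂ _≤ᵥ_ (AG.identityˡ h) e (+-mono h 0≤h)) 0≤h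

module Valuations (EM : ExcludedMiddle 0ℓ) (G : OrderedAbelianGroup) (F : ValuedField G) where
  open OrderedAbelianGroup G
  open ValuedField F
  open ExtendedValues EM G
  private
    module TO = IsTotalOrder isTotalOrder
    module AG = IsAbelianGroup isAbelianGroup
    ring : CommutativeRing 0ℓ 0ℓ
    ring = record { isCommutativeRing = isCommRing }
    module R = CommutativeRing ring
    ΓGroup : Group 0ℓ 0ℓ
    ΓGroup = record { isGroup = AG.isGroup }
  open import Algebra.Properties.Ring R.ring using (-1*x≈-x; -‿involutive; -0#≈0#)
  open import Algebra.Properties.Group R.+-group using (//-rightDividesˡ)
  open import Algebra.Properties.AbelianGroup R.+-abelianGroup
    using (⁻¹-anti-homo‿-; xyx⁻¹≈y; ⁻¹-∙-comm)
  open import Algebra.Properties.CommutativeSemigroup R.+-commutativeSemigroup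
    using (interchange)
  open import Algebra.Properties.Loop (GroupProperties.loop ΓGroup)
    using (identityʳ-unique)
  open ≡-Reasoning

  minus-plus : ∀ a b → (a - b) + b ≡ a
  minus-plus a b = //-rightDividesˡ b a

  neg-minus : ∀ a b → - (a - b) ≡ b - a
  neg-minus = ⁻¹-anti-homo‿-

  telescope : ∀ p q r → (p - q) + (q - r) ≡ p - r
  telescope p q r = begin
    (p - q) + (q - r)     ≡⟨ R.+-assoc p (- q) (q - r) ⟩
    p + (- q + (q - r))   ≡⟨ cong (p +_) (sym (R.+-assoc (- q) q (- r))) ⟩
    p + ((- q + q) - r)   ≡⟨ cong (λ t → p + (t - r)) (R.-‿inverseˡ q) ⟩
    p + (0# - r)          ≡⟨ cong (p +_) (R.+-identityˡ (- r)) ⟩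
    p - r                 ∎

  sum-minus-sum : ∀ a b p q → (a + b) - (p + q) ≡ (a - p) + (b - q)
  sum-minus-sum a b p q = begin
    (a + b) + - (p + q)   ≡⟨ cong ((a + b) +_) (sym (⁻¹-∙-comm p q)) ⟩
    (a + b) + (- p + - q) ≡⟨ interchange a b (- p) (- q) ⟩
    (a - p) + (b - q)     ∎

  -- Swapping the roles of the two sides of the key lemma below.
  reverse-difference : ∀ s u a b → (s + (b - a)) - u ≡ - ((u + (a - b)) - s)
  reverse-difference s u a b = begin
    (s + (b - a)) - u         ≡⟨ R.+-assoc s (b - a) (- u) ⟩
    s + ((b - a) - u)         ≡⟨ cong (s +_) (R.+-comm (b - a) (- u)) ⟩
    s + (- u + (b - a))       ≡⟨ cong (λ t → s + (- u + t)) (sym (neg-minus a b)) ⟩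
    s + (- u + - (a - b))     ≡⟨ cong (s +_) (⁻¹-∙-comm u (a - b)) ⟩
    s - (u + (a - b))         ≡⟨ sym (neg-minus (u + (a - b)) s) ⟩
    - ((u + (a - b)) - s)     ∎

  -- Units ±1 have valuation 0, hence v(-x) = v(x).  For 1: v(1) = v(1) + v(1)
  -- and v(1) ≠ ∞; for -1: 2·v(-1) = v(1) = 0 in a torsion-free group.
  v-1 : v 1# ≡ fin 0ᵥ
  v-1 with v 1# | trans (cong v (sym (R.*-identityˡ 1#))) (v-mul 1# 1#) | v-∞ 1#
  ... | ∞     | _ | v1≡∞⇒1≡0 = ⊥-elim (0≢1 (sym (v1≡∞⇒1≡0 refl)))
  ... | fin g | e | _        = cong fin (identityʳ-unique g g (sym (fin-injective e)))

  v-minus-1-twice : v (- 1#) +∞ v (- 1#) ≡ fin 0ᵥ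
  v-minus-1-twice = begin
    v (- 1#) +∞ v (- 1#) ≡⟨ sym (v-mul (- 1#) (- 1#)) ⟩
    v (- 1# * - 1#)       ≡⟨ cong v (trans (-1*x≈-x (- 1#)) (-‿involutive 1#)) ⟩
    v 1#                  ≡⟨ v-1 ⟩
    fin 0ᵥ                ∎

  v-minus-1 : v (- 1#) ≡ fin 0ᵥ
  v-minus-1 with v (- 1#) | v-minus-1-twice
  ... | fin h | e = cong fin (double-zero h (fin-injective e))

  v-neg : ∀ x → v (- x) ≡ v x
  v-neg x = begin
    v (- x)               ≡⟨ cong v (sym (-1*x≈-x x)) ⟩
    v (- 1# * x)          ≡⟨ v-mul (- 1#) x ⟩
    v (- 1#) +∞ v x       ≡⟨ cong (_+∞ v x) v-minus-1 ⟩
    fin 0ᵥ +∞ v x         ≡⟨ left-unit (v x) ⟩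
    v x                   ∎
    where
    left-unit : ∀ y → fin 0ᵥ +∞ y ≡ y
    left-unit (fin y) = cong fin (AG.identityˡ y)
    left-unit ∞       = refl

  v-dominant : ∀ x y → v y <∞ v x → v (x + y) ≡ v y
  v-dominant x y vy<vx = ≤∞-antisym upper lower
    where
    lower : v y ≤∞ v (x + y)
    lower with v-add x y
    ... | inj₁ vx≤ = ≤∞-trans {v y} {v x} {v (x + y)} (<⇒≤∞ {v y} vy<vx) vx≤
    ... | inj₂ vy≤ = vy≤
    upper : v (x + y) ≤∞ v y
    upper with v-add (x + y) (- x)
    ... | inj₁ p = subst (λ t → v (x + y) ≤∞ v t) (xyx⁻¹≈y x y) p
    ... | inj₂ p = ⊥-elim (≤⇒≯∞ (subst₂ _≤∞_ (v-neg x) (cong v (xyx⁻¹≈y x y)) p) vy<vx)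

  -- e is ρ-small: v(e) > ρ.  Zero is small at every level, including ∞.
  Small : K → Val Γ → Set
  Small e ρ = (ρ <∞ v e) ⊎ (e ≡ 0#)

  small-+ : ∀ {ρ} e f → Small e ρ → Small f ρ → Small (e + f) ρ
  small-+ e f (inj₂ e≡0) sf = subst (λ t → Small t _) (sym e+f≡f) sf
    where
    e+f≡f : e + f ≡ f
    e+f≡f = trans (cong (_+ f) e≡0) (R.+-identityˡ f)
  small-+ e f (inj₁ se) (inj₂ f≡0) = inj₁ (subst (λ t → _ <∞ v t) (sym e+f≡e) se)
    where
    e+f≡e : e + f ≡ e
    e+f≡e = trans (cong (e +_) f≡0) (R.+-identityʳ e)
  small-+ e f (inj₁ se) (inj₁ sf) with v-add e f
  ... | inj₁ ve≤ = inj₁ (<-≤-trans∞ se ve≤)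
  ... | inj₂ vf≤ = inj₁ (<-≤-trans∞ sf vf≤)

  small-neg : ∀ {ρ} e → Small e ρ → Small (- e) ρ
  small-neg e (inj₁ se)  = inj₁ (subst (_ <∞_) (sym (v-neg e)) se)
  small-neg e (inj₂ e≡0) = inj₂ (trans (cong -_ e≡0) -0#≈0#)

  small-swap : ∀ {ρ} a b → Small (a - b) ρ → Small (b - a) ρ
  small-swap a b s = subst (λ t → Small t _) (neg-minus a b) (small-neg (a - b) s)

  small-antitone : ∀ {ρ′ ρ} e → ρ′ ≤∞ ρ → Small e ρ → Small e ρ′
  small-antitone e ρ′≤ρ (inj₁ se)  = inj₁ (≤-<-trans∞ ρ′≤ρ se)
  small-antitone e ρ′≤ρ (inj₂ e≡0) = inj₂ e≡0

  difference-zero⇒≡ : ∀ {a b} → a - b ≡ 0# → a ≡ b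
  difference-zero⇒≡ {a} {b} e = trans (sym (minus-plus a b)) (trans (cong (_+ b) e) (R.+-identityˡ b))

  rv⇒small : ∀ {a b δ} → a ≈rv[ δ ] b → Small (a - b) (v b ⊹ δ)
  rv⇒small {a} {b} (inj₁ (a≡0 , b≡0)) = inj₂ (trans (cong₂ _-_ a≡0 b≡0) (R.-‿inverseʳ 0#))
  rv⇒small (inj₂ (_ , _ , h)) = inj₁ h

  small⇒rv : ∀ {a b δ} → 0ᵥ ≤ᵥ δ → Small (a - b) (v b ⊹ δ) → a ≈rv[ δ ] b
  small⇒rv {a} {b} {δ} 0≤δ s with EM {b ≡ 0#}
  small⇒rv {a} {b} {δ} 0≤δ (inj₂ a-b≡0) | yes b≡0 = inj₁ (trans (difference-zero⇒≡ a-b≡0) b≡0 , b≡0)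
  small⇒rv {a} {b} {δ} 0≤δ (inj₁ h)     | yes b≡0 = ⊥-elim (nothing-above-∞ h)
    where
    nothing-above-∞ : ¬ (v b ⊹ δ) <∞ v (a - b)
    nothing-above-∞ rewrite b≡0 | v-0 = λ ()
  small⇒rv {a} {b} {δ} 0≤δ (inj₁ h)     | no b≢0 = inj₂ (a≢0 , b≢0 , h)
    where
    a≢0 : ¬ a ≡ 0#
    a≢0 a≡0 = ≤⇒≯∞ (≤-⊹ (v b) 0≤δ) (subst (λ t → (v b ⊹ δ) <∞ t) v[a-b]≡vb h)
      where
      v[a-b]≡vb : v (a - b) ≡ v b
      v[a-b]≡vb = trans (cong v (trans (cong (_- b) a≡0) (R.+-identityˡ (- b)))) (v-neg b)
  small⇒rv {a} {b} {δ} 0≤δ (inj₂ a-b≡0) | no b≢0 =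
    inj₂ ((λ a≡0 → b≢0 (trans (sym a≡b) a≡0)) , b≢0 ,
          subst (λ t → (v b ⊹ δ) <∞ v t) (sym a-b≡0) (subst ((v b ⊹ δ) <∞_) (sym v-0) below-∞))
    where
    a≡b : a ≡ b
    a≡b = difference-zero⇒≡ a-b≡0
    below-∞ : (v b ⊹ δ) <∞ ∞
    below-∞ with v b | v-∞ b
    ... | fin _ | _         = tt
    ... | ∞     | vb≡∞⇒b≡0 = b≢0 (vb≡∞⇒b≡0 refl)

  rv-v : ∀ {a b δ} → 0ᵥ ≤ᵥ δ → a ≈rv[ δ ] b → v a ≡ v b
  rv-v {a} {b} {δ} 0≤δ r with rv⇒small r
  ... | inj₂ a-b≡0 = cong v (difference-zero⇒≡ a-b≡0)
  ... | inj₁ h     = trans (cong v (sym (minus-plus a b)))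
                           (v-dominant (a - b) b (≤-<-trans∞ (≤-⊹ (v b) 0≤δ) h))

  rv-sym : ∀ {a b δ} → 0ᵥ ≤ᵥ δ → a ≈rv[ δ ] b → b ≈rv[ δ ] a
  rv-sym {a} {b} {δ} 0≤δ r =
    small⇒rv 0≤δ (subst (λ t → Small (b - a) (t ⊹ δ)) (sym (rv-v 0≤δ r)) (small-swap a b (rv⇒small r)))

  rv-refl : ∀ {a δ} → 0ᵥ ≤ᵥ δ → a ≈rv[ δ ] a
  rv-refl {a} 0≤δ = small⇒rv 0≤δ (inj₂ (R.-‿inverseʳ a))

  -- The only subtle term is t - q: its smallness fails only if v(t) is below
  -- both v(s) and v(u), but then v(p + q) = v(t) ≠ v(u) = v(w).
  sum-close : ∀ {γ δ s t u p q w ρ} → 0ᵥ ≤ᵥ γ → γ ≤ᵥ δ →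
              p ≈rv[ δ ] s → q ≈rv[ δ ] t → (p + q) ≈rv[ δ ] w → w ≈rv[ γ ] u →
              ρ ≤∞ (v s ⊹ δ) → ρ ≤∞ (v u ⊹ γ) → Small ((s + t) - u) ρ
  sum-close {γ} {δ} {s} {t} {u} {p} {q} {w} {ρ} 0≤γ γ≤δ p≈s q≈t p+q≈w w≈u ρ≤s ρ≤u =
    subst (λ e → Small e ρ) (telescope (s + t) (p + q) u)
      (small-+ _ _ (subst (λ e → Small e ρ) (sym (sum-minus-sum s t p q)) (small-+ _ _ s-p t-q))
                   (subst (λ e → Small e ρ) (telescope (p + q) w u) (small-+ _ _ p+q-w w-u)))
    where
    0≤δ : 0ᵥ ≤ᵥ δ
    0≤δ = TO.trans 0≤γ γ≤δ
    vw≡vu : v w ≡ v u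
    vw≡vu = rv-v 0≤γ w≈u
    ρ≤uδ : ρ ≤∞ (v u ⊹ δ)
    ρ≤uδ = ≤∞-trans {ρ} {v u ⊹ γ} {v u ⊹ δ} ρ≤u (⊹-monoʳ (v u) γ≤δ)

    ρ≤tδ : ρ ≤∞ (v t ⊹ δ)
    ρ≤tδ with ≤-or->∞ ρ (v t ⊹ δ)
    ... | inj₁ ρ≤ = ρ≤
    ... | inj₂ tδ<ρ = ⊥-elim (<∞-irrefl (subst (v t <∞_) (sym vt≡vu) vt<vu))
      where
      vt<vs : v t <∞ v s
      vt<vs = ⊹-cancel-< δ (<-≤-trans∞ {v t ⊹ δ} tδ<ρ ρ≤s)
      vt<vu : v t <∞ v u
      vt<vu = ⊹-cancel-< δ (<-≤-trans∞ {v t ⊹ δ} tδ<ρ ρ≤uδ)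
      vq<vp : v q <∞ v p
      vq<vp = subst₂ _<∞_ (sym (rv-v 0≤δ q≈t)) (sym (rv-v 0≤δ p≈s)) vt<vs
      vt≡vu : v t ≡ v u
      vt≡vu = begin
        v t       ≡⟨ sym (rv-v 0≤δ q≈t) ⟩
        v q       ≡⟨ sym (v-dominant p q vq<vp) ⟩
        v (p + q) ≡⟨ rv-v 0≤δ p+q≈w ⟩
        v w       ≡⟨ vw≡vu ⟩
        v u       ∎

    s-p : Small (s - p) ρ
    s-p = small-antitone _ ρ≤s (small-swap p s (rv⇒small p≈s))
    t-q : Small (t - q) ρ
    t-q = small-antitone _ ρ≤tδ (small-swap q t (rv⇒small q≈t))
    p+q-w : Small ((p + q) - w) ρ
    p+q-w = small-antitone _ (subst (λ x → ρ ≤∞ (x ⊹ δ)) (sym vw≡vu) ρ≤uδ) (rv⇒small p+q≈w)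
    w-u : Small (w - u) ρ
    w-u = small-antitone _ ρ≤u (rv⇒small w≈u)

module Conjunctions (G : OrderedAbelianGroup) (F : ValuedField G) where
  open LeadingTerm G
  open Semantics F

  ⋀ : ∀ {X} m → (Fin m → Formula X) → Formula X
  ⋀ zero    φ = ⊤F
  ⋀ (suc m) φ = andF (φ Fin.zero) (⋀ m (λ i → φ (Fin.suc i)))

  sat-⋀ : ∀ {X} m (φ : Fin m → Formula X) (ρ : Env X) → (∀ i → Sat (φ i) ρ) → Sat (⋀ m φ) ρ
  sat-⋀ zero    φ ρ all = tt
  sat-⋀ (suc m) φ ρ all = all Fin.zero , sat-⋀ m (λ i → φ (Fin.suc i)) ρ (λ i → all (Fin.suc i))

  ⋀-sat : ∀ {X} m (φ : Fin m → Formula X) (ρ : Env X) → Sat (⋀ m φ) ρ → ∀ i → Sat (φ i) ρ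
  ⋀-sat (suc m) φ ρ (now , _)   Fin.zero    = now
  ⋀-sat (suc m) φ ρ (_ , later) (Fin.suc i) = ⋀-sat m (λ i → φ (Fin.suc i)) ρ later i

module Elimination (EM : ExcludedMiddle 0ℓ) (G : OrderedAbelianGroup) (F : ValuedField G)
                   (n : ℕ) (δ : Fin n → OrderedAbelianGroup.Γ G)
                   (nn : ∀ i → OrderedAbelianGroup._≤ᵥ_ G (OrderedAbelianGroup.0ᵥ G) (δ i)) where
  open OrderedAbelianGroup G
  open ValuedField F
  open ExtendedValues EM G
  open Valuations EM G F
  open LeadingTerm G
  open Semantics F
  open Params G
  open Conjunctions G F
  private
    module TO = IsTotalOrder isTotalOrder

  X : Sort → Set
  X = Param n δ nn

  Agree : (i j : Fin n) → δ j ≤ᵥ δ i → Formula X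
  Agree i j δj≤δi = existsRV (δ i) (nn i)
    (andF (⊕F (var (old (zP i))) (var (old (aP i j))) (var new))
          (eqF (projT {q = nn j} δj≤δi (var new)) (var (old (zP j)))))

  AgreePair : (i j : Fin n) → δ j ≤ᵥ δ i ⊎ δ i ≤ᵥ δ j → Formula X
  AgreePair i j (inj₁ δj≤δi) = Agree i j δj≤δi
  AgreePair i j (inj₂ δi≤δj) = Agree j i δi≤δj

  ψ : Formula X
  ψ = ⋀ n (λ i → ⋀ n (λ j → AgreePair i j (TO.total (δ j) (δ i))))

  module _ (z a d : Fin n → K) where
    env : Env X
    env = paramEnv F z a d

    Solution : K → Set
    Solution x = ∀ i → z i ≈rv[ δ i ] (x - a i)

    solution⇒agree : ∀ x → Solution x → ∀ i j h → Sat (Agree i j h) env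
    solution⇒agree x sol i j h =
      (x - a j) ,
      ((x - a i) , (a i - a j) , rv-sym (nn i) (sol i) , rv-refl (nn i) ,
        subst (λ e → e ≈rv[ δ i ] (x - a j)) (sym (telescope x (a i) (a j))) (rv-refl (nn i))) ,
      rv-sym (nn j) (sol j)

    solution⇒ψ : ∀ x → Solution x → Sat ψ env
    solution⇒ψ x sol = sat-⋀ n _ env λ i → sat-⋀ n _ env λ j → agree-pair i j (TO.total (δ j) (δ i))
      where
      agree-pair : ∀ i j o → Sat (AgreePair i j o) env
      agree-pair i j (inj₁ h) = solution⇒agree x sol i j h
      agree-pair i j (inj₂ h) = solution⇒agree x sol j i h

    ρ : Fin n → Val Γ
    ρ k = v (z k) ⊹ δ k

    agree⇒close : ∀ k j o → ρ j ≤∞ ρ k → Sat (AgreePair k j o) env →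
                  Small ((z k + (a k - a j)) - z j) (ρ j)
    agree⇒close k j (inj₁ h) ρj≤ρk (w , (p , q , p≈ , q≈ , p+q≈) , w≈) =
      sum-close (nn j) h p≈ q≈ p+q≈ w≈ ρj≤ρk (≤∞-refl {ρ j})
    agree⇒close k j (inj₂ h) ρj≤ρk (w , (p , q , p≈ , q≈ , p+q≈) , w≈) =
      subst (λ e → Small e (ρ j)) (sym (reverse-difference (z k) (z j) (a j) (a k)))
        (small-neg _ (sum-close (nn k) h p≈ q≈ p+q≈ w≈ (≤∞-refl {ρ j}) ρj≤ρk))

    ψ⇒solution : Sat ψ env → ∃ Solution
    ψ⇒solution sat with maximum n ρ
    ... | inj₂ empty = 0# , λ i → ⊥-elim (empty i)
    ... | inj₁ (k , ρk-max) = z k + a k , λ j →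
      rv-sym (nn j) (small⇒rv (nn j)
        (subst (λ e → Small (e - z j) (ρ j)) (sym (+-assoc (z k) (a k) (- a j)))
          (agree⇒close k j (TO.total (δ j) (δ k)) (ρk-max j) (⋀-sat n _ env (⋀-sat n _ env sat k) j))))
      where open IsCommutativeRing isCommRing using (+-assoc)

-- Proposition 4.1.
proposition4p1 : ExcludedMiddle 0ℓ →
    (G : OrderedAbelianGroup) (F : ValuedField G) →
    ValuedField.Henselian F → ValuedField.CharZero F →
    (n : ℕ) (δ : Fin n → OrderedAbelianGroup.Γ G)
    (nn : ∀ i → OrderedAbelianGroup._≤ᵥ_ G (OrderedAbelianGroup.0ᵥ G) (δ i)) →
    ∃ λ (ψ : LeadingTerm.Formula G (Params.Param G n δ nn)) →
      ∀ (z a d : Fin n → ValuedField.K F) →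
      (∀ i → ValuedField.v F (d i) ≡ fin (δ i)) →
      ((∃ λ x → ∀ i → ValuedField._≈rv[_]_ F (z i) (δ i) (ValuedField._-_ F x (a i)))
        → LeadingTerm.Semantics.Sat G F ψ (Params.paramEnv G F z a d))
      × (LeadingTerm.Semantics.Sat G F ψ (Params.paramEnv G F z a d)
        → ∃ λ x → ∀ i → ValuedField._≈rv[_]_ F (z i) (δ i) (ValuedField._-_ F x (a i)))
proposition4p1 EM G F _ _ n δ nn =
  ψ , λ z a d _ → (λ { (x , sol) → solution⇒ψ z a d x sol }) , ψ⇒solution z a d
  where open Elimination EM G F n δ nn
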